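{- Let $H(x)=\sum_{n\ge1}a_nx^n$, where $a_n$ is the number of $2$-row-restricted slicings of size $n$. Then $$H(x)=\frac{x\,(H(x)+1)}{1-x\,(H(x)+1)^2}.$$
   Context: Parallelogram polyominoes are edge-connected sets of unit cells bounded by two lattice paths with steps $(0,1)$ and $(1,0)$ meeting only at their endpoints. The size is $k+\ell-1$ for a $k\times\ell$ bounding rectangle. A Baxter slicing of size $n$ is such a polyomino of size $n$ divided into $n$ blocks, defined recursively: - for $n=1$, the single cell is the single block; - for $n\ge2$, one block is the topmost row (horizontal block) or the rightmost column (vertical block), and the other blocks form a Baxter slicing of the polyomino obtained by deleting it. A $2$-row-restricted slicing is a Baxter slicing all of whose horizontal blocks have width at most $2$. -}

module Defs where

open import Data.Nat using (ℕ; zero; suc; _+_; _*_; _∸_; _≤_; _<_; _≡ᵇ_)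
open import Data.Bool using (if_then_else_)
open import Data.List using (List; []; _∷_; [_]; length; map)
open import Data.Product using (Σ; _×_; _,_; proj₁; proj₂)
open import Data.Unit using (⊤)
open import Relation.Binary.PropositionalEquality using (_≡_)

-- A polyomino is the list of its columns from left to right; column i is
-- the pair (lo , hi) meaning it occupies the cells in rows lo, lo+1, …, hi-1.
-- Translation is normalised: the leftmost column starts at x = 0 and has
-- lo = 0 (the bottom-left corner of the bounding box is the origin).
-- The two bounding lattice paths (steps (1,0),(0,1)) meet only at their
-- endpoints iff every column is nonempty, lo and hi are weakly increasing,
-- and consecutive columns share an edge (lo' < hi).

Col : Set
Col = ℕ × ℕ

data ColsOK : List Col → Set where
  one  : ∀ {l h} → l < h → ColsOK [ (l , h) ]
  cons : ∀ {l h l′ h′ cs} → l < h → l ≤ l′ → h ≤ h′ → l′ < h →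
         ColsOK ((l′ , h′) ∷ cs) → ColsOK ((l , h) ∷ (l′ , h′) ∷ cs)

data IsPP : List Col → Set where
  isPP : ∀ {h cs} → ColsOK ((0 , h) ∷ cs) → IsPP ((0 , h) ∷ cs)

-- height k of the bounding box = top of the rightmost column
lastHi : List Col → ℕ
lastHi []           = 0
lastHi (c ∷ [])     = proj₂ c
lastHi (_ ∷ d ∷ cs) = lastHi (d ∷ cs)

-- size = k + ℓ - 1 for a k × ℓ bounding box
size : List Col → ℕ
size P = length P + lastHi P ∸ 1

-- delete the topmost row (row k-1): exactly the columns with hi = k lose a cell
lowerTop : ℕ → Col → Col
lowerTop k (l , h) = if h ≡ᵇ k then (l , h ∸ 1) else (l , h)

removeTop : List Col → List Col
removeTop P = map (lowerTop (lastHi P)) P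

countTop : ℕ → List Col → ℕ
countTop k []             = 0
countTop k ((l , h) ∷ cs) = (if h ≡ᵇ k then 1 else 0) + countTop k cs

topRowWidth : List Col → ℕ
topRowWidth P = countTop (lastHi P) P

removeRight : List Col → List Col
removeRight []           = []
removeRight (_ ∷ [])     = []
removeRight (c ∷ d ∷ cs) = c ∷ removeRight (d ∷ cs)

-- Baxter slicings of a polyomino P (P of size n is cut into n blocks).
-- The block containing the top-right cell determines the first step, so
-- these derivation trees are in bijection with the slicings (block partitions).

data BaxterSlicing : List Col → Set where
  cell  : BaxterSlicing [ (0 , 1) ]
  horiz : ∀ {P} → IsPP P → 2 ≤ size P →
          IsPP (removeTop P) → suc (size (removeTop P)) ≡ size P →
          BaxterSlicing (removeTop P) → BaxterSlicing P
  vert  : ∀ {P} → IsPP P → 2 ≤ size P →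
          IsPP (removeRight P) → suc (size (removeRight P)) ≡ size P →
          BaxterSlicing (removeRight P) → BaxterSlicing P

TwoRowRestricted : ∀ {P} → BaxterSlicing P → Set
TwoRowRestricted cell                     = ⊤
TwoRowRestricted (horiz {P} _ _ _ _ s)    = (topRowWidth P ≤ 2) × TwoRowRestricted s
TwoRowRestricted (vert _ _ _ _ s)         = TwoRowRestricted s

TwoRowSlicing : ℕ → Set
TwoRowSlicing n = Σ (List Col) λ P → (size P ≡ n) × Σ (BaxterSlicing P) TwoRowRestricted

Series : Set
Series = ℕ → ℕ

sumTo : ℕ → (ℕ → ℕ) → ℕ
sumTo zero    f = 0
sumTo (suc m) f = sumTo m f + f m

_⊕_ : Series → Series → Series
(f ⊕ g) n = f n + g n

_⊛_ : Series → Series → Series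
(f ⊛ g) n = sumTo (suc n) (λ i → f i * g (n ∸ i))

infixl 6 _⊕_
infixl 7 _⊛_

𝟙 : Series
𝟙 zero    = 1
𝟙 (suc n) = 0

X : Series
X (suc zero) = 1
X _          = 0

genFun : (ℕ → ℕ) → Series
genFun a zero    = 0
genFun a (suc n) = a (suc n)

-- A 2-row-restricted slicing is grown from a single cell by repeatedly adding the block
-- that contains the top-right cell: a new rightmost column of j + 1 cells flush with the
-- top (j ≤ k, where k + 1 is the height of the previous last column), a top row over the
-- last column, or a top row over the last two columns when both reach the top.  The
-- available moves depend only on the state (k , r), r recording whether the top row is at
-- least two cells wide, so slicings of size m + 1 are the walks of length m from (0 , false).
-- Writing N k r for the series counting walks from (k , r), induction on the length gives
-- N (k + 1) r = N k r · (1 + x N 0 true).  Hence H = x N 0 false and L = x N 0 true satisfy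
-- H = x (1 + H)(1 + L) and L = x (1 + L)(1 + H + L); the second equation determines L, and
-- H (1 + H) satisfies it too, so L = H (1 + H) and H = x (1 + H) + x H (1 + H)².

module Submission where

open import Data.Bool using (Bool; true; false; if_then_else_)
open import Data.Empty using (⊥; ⊥-elim)
open import Data.Fin using (Fin; toℕ; fromℕ<) renaming (zero to fzero; suc to fsuc)
open import Data.Fin.Permutation using (↔⇒≡)
open import Data.Fin.Properties using (+↔⊎; 0↔⊥; toℕ-fromℕ<; toℕ-injective; toℕ<n)
open import Data.List using (List; []; _∷_; [_]; _∷ʳ_; length; map; foldr)
open import Data.List.Properties using (∷-injectiveˡ; ∷-injectiveʳ)
open import Data.Nat using (ℕ; zero; suc; _+_; _*_; _∸_; _≤_; _<_; z≤n; s≤s; s≤s⁻¹; _≡ᵇ_)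
open import Data.Nat.Properties
open import Algebra.Properties.CommutativeSemigroup +-commutativeSemigroup using (interchange; x∙yz≈y∙xz)
open import Data.Nat.Tactic.RingSolver using (solve-∀)
open import Data.Product using (Σ; _×_; _,_; proj₁; proj₂)
open import Data.Sum using (_⊎_; inj₁; inj₂)
open import Data.Sum.Function.Propositional using (_⊎-↔_)
open import Data.Unit using (tt)
open import Function.Base using (_∘_; _∘′_)
open import Function.Bundles using (_↔_; mk↔ₛ′)
open import Function.Properties.Inverse using (↔-sym; ↔-trans)
open import Relation.Nullary using (yes; no)
open import Relation.Binary.PropositionalEquality hiding ([_])
import Relation.Binary.Reasoning.Setoid as SetoidReasoning
open import Defs

-- Unlike sumTo, ∑ n g = g 0 + (g 1 + ⋯) unfolds from the front.
∑ : ℕ → (ℕ → ℕ) → ℕ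
∑ zero    g = 0
∑ (suc n) g = g 0 + ∑ n (g ∘ suc)

∑-snoc : ∀ n g → ∑ (suc n) g ≡ ∑ n g + g n
∑-snoc zero    g = +-comm (g 0) 0
∑-snoc (suc n) g = trans (cong (g 0 +_) (∑-snoc n (g ∘ suc))) (sym (+-assoc (g 0) _ _))

sumTo≡∑ : ∀ n g → sumTo n g ≡ ∑ n g
sumTo≡∑ zero    g = refl
sumTo≡∑ (suc n) g = trans (cong (_+ g n) (sumTo≡∑ n g)) (sym (∑-snoc n g))

∑-cong : ∀ n {f g} → (∀ i → i < n → f i ≡ g i) → ∑ n f ≡ ∑ n g
∑-cong zero    f≡g = refl
∑-cong (suc n) f≡g = cong₂ _+_ (f≡g 0 (s≤s z≤n)) (∑-cong n (λ i i<n → f≡g (suc i) (s≤s i<n)))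

∑-zero : ∀ n → ∑ n (λ _ → 0) ≡ 0
∑-zero zero    = refl
∑-zero (suc n) = ∑-zero n

∑-distrib-+ : ∀ n f g → ∑ n (λ i → f i + g i) ≡ ∑ n f + ∑ n g
∑-distrib-+ zero    f g = refl
∑-distrib-+ (suc n) f g rewrite ∑-distrib-+ n (f ∘ suc) (g ∘ suc) = interchange (f 0) (g 0) _ _

∑-*ˡ : ∀ n c f → ∑ n (λ i → c * f i) ≡ c * ∑ n f
∑-*ˡ zero    c f = sym (*-zeroʳ c)
∑-*ˡ (suc n) c f rewrite ∑-*ˡ n c (f ∘ suc) = sym (*-distribˡ-+ c (f 0) _)

infixl 7 _⋆_
_⋆_ : Series → Series → Series
(A ⋆ B) n = ∑ (suc n) (λ i → A i * B (n ∸ i))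

module ≗-Reasoning = SetoidReasoning (ℕ →-setoid ℕ)

⊛≗⋆ : ∀ A B → A ⊛ B ≗ A ⋆ B
⊛≗⋆ A B n = sumTo≡∑ (suc n) _

⋆-zero : ∀ A B → (A ⋆ B) 0 ≡ A 0 * B 0
⋆-zero A B = +-identityʳ _

⋆-cong-≤ : ∀ n {A A′ B B′} → (∀ i → i ≤ n → A i ≡ A′ i) → (∀ i → i ≤ n → B i ≡ B′ i) →
           (A ⋆ B) n ≡ (A′ ⋆ B′) n
⋆-cong-≤ n A≡A′ B≡B′ =
  ∑-cong (suc n) (λ i i≤n → cong₂ _*_ (A≡A′ i (s≤s⁻¹ i≤n)) (B≡B′ (n ∸ i) (m∸n≤m n i)))

⋆-cong : ∀ {A A′ B B′} → A ≗ A′ → B ≗ B′ → A ⋆ B ≗ A′ ⋆ B′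
⋆-cong A≗A′ B≗B′ n = ⋆-cong-≤ n (λ i _ → A≗A′ i) (λ i _ → B≗B′ i)

⋆-congˡ : ∀ A {B B′} → B ≗ B′ → A ⋆ B ≗ A ⋆ B′
⋆-congˡ A = ⋆-cong {A} {A} (λ _ → refl)

⋆-congʳ : ∀ {A A′} B → A ≗ A′ → A ⋆ B ≗ A′ ⋆ B
⋆-congʳ {A} {A′} B A≗A′ = ⋆-cong {A} {A′} {B} {B} A≗A′ (λ _ → refl)

⊕-cong : ∀ {A A′ B B′} → A ≗ A′ → B ≗ B′ → A ⊕ B ≗ A′ ⊕ B′
⊕-cong A≗A′ B≗B′ n = cong₂ _+_ (A≗A′ n) (B≗B′ n)

⊕-congˡ : ∀ A {B B′} → B ≗ B′ → A ⊕ B ≗ A ⊕ B′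
⊕-congˡ A B≗B′ n = cong (A n +_) (B≗B′ n)

⊕-congʳ : ∀ {A A′} B → A ≗ A′ → A ⊕ B ≗ A′ ⊕ B
⊕-congʳ B A≗A′ n = cong (_+ B n) (A≗A′ n)

⊕-comm : ∀ A B → A ⊕ B ≗ B ⊕ A
⊕-comm A B n = +-comm (A n) (B n)

⋆-distribʳ-⊕ : ∀ A A′ B → (A ⊕ A′) ⋆ B ≗ A ⋆ B ⊕ A′ ⋆ B
⋆-distribʳ-⊕ A A′ B n =
  trans (∑-cong (suc n) (λ i _ → *-distribʳ-+ (B (n ∸ i)) (A i) (A′ i)))
        (∑-distrib-+ (suc n) (λ i → A i * B (n ∸ i)) (λ i → A′ i * B (n ∸ i)))

⋆-distribˡ-⊕ : ∀ A B B′ → A ⋆ (B ⊕ B′) ≗ A ⋆ B ⊕ A ⋆ B′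
⋆-distribˡ-⊕ A B B′ n =
  trans (∑-cong (suc n) (λ i _ → *-distribˡ-+ (A i) (B (n ∸ i)) (B′ (n ∸ i))))
        (∑-distrib-+ (suc n) (λ i → A i * B (n ∸ i)) (λ i → A i * B′ (n ∸ i)))

⋆-scaleˡ : ∀ c A B n → ((λ i → c * A i) ⋆ B) n ≡ c * (A ⋆ B) n
⋆-scaleˡ c A B n =
  trans (∑-cong (suc n) (λ i _ → *-assoc c (A i) (B (n ∸ i)))) (∑-*ˡ (suc n) c (λ i → A i * B (n ∸ i)))

⋆-comm : ∀ A B → A ⋆ B ≗ B ⋆ A
⋆-comm A B zero = cong (_+ 0) (*-comm (A 0) (B 0))
⋆-comm A B (suc zero) = swap (A 0) (B 1) (A 1) (B 0)
  where
  swap : ∀ a b c d → a * b + (c * d + 0) ≡ d * c + (b * a + 0)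
  swap = solve-∀
⋆-comm A B (suc (suc n)) = begin
  a + ((A ∘ suc) ⋆ B) (suc n)                          ≡⟨ cong (a +_) (⋆-comm (A ∘ suc) B (suc n)) ⟩
  a + (b + ((B ∘ suc) ⋆ (A ∘ suc)) n)                  ≡⟨ cong (λ z → a + (b + z)) (⋆-comm (B ∘ suc) (A ∘ suc) n) ⟩
  a + (b + ((A ∘ suc) ⋆ (B ∘ suc)) n)                  ≡⟨ x∙yz≈y∙xz a b _ ⟩
  b + (a + ((A ∘ suc) ⋆ (B ∘ suc)) n)                  ≡⟨ cong (b +_) (⋆-comm A (B ∘ suc) (suc n)) ⟩
  b + ((B ∘ suc) ⋆ A) (suc n)                          ∎
  where
  open ≡-Reasoning
  a = A 0 * B (2 + n)
  b = B 0 * A (2 + n)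

⋆-assoc : ∀ A B C → (A ⋆ B) ⋆ C ≗ A ⋆ (B ⋆ C)
⋆-assoc A B C zero = rearrange (A 0) (B 0) (C 0)
  where
  rearrange : ∀ a b c → (a * b + 0) * c + 0 ≡ a * (b * c + 0) + 0
  rearrange = solve-∀
⋆-assoc A B C (suc n) = begin
  (A ⋆ B) 0 * C (suc n) + (((A ⋆ B) ∘ suc) ⋆ C) n
    ≡⟨ cong (λ x → x * C (suc n) + (((A ⋆ B) ∘ suc) ⋆ C) n) (⋆-zero A B) ⟩
  A 0 * B 0 * C (suc n) + (((λ i → A 0 * B (suc i)) ⊕ (A ∘ suc) ⋆ B) ⋆ C) n
    ≡⟨ cong (A 0 * B 0 * C (suc n) +_) (⋆-distribʳ-⊕ (λ i → A 0 * B (suc i)) ((A ∘ suc) ⋆ B) C n) ⟩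
  A 0 * B 0 * C (suc n) + (((λ i → A 0 * B (suc i)) ⋆ C) n + (((A ∘ suc) ⋆ B) ⋆ C) n)
    ≡⟨ cong₂ (λ x y → A 0 * B 0 * C (suc n) + (x + y)) (⋆-scaleˡ (A 0) (B ∘ suc) C n) (⋆-assoc (A ∘ suc) B C n) ⟩
  A 0 * B 0 * C (suc n) + (A 0 * ((B ∘ suc) ⋆ C) n + ((A ∘ suc) ⋆ (B ⋆ C)) n)
    ≡⟨ factor (A 0) (B 0) (C (suc n)) _ _ ⟩
  A 0 * (B ⋆ C) (suc n) + ((A ∘ suc) ⋆ (B ⋆ C)) n
    ∎
  where
  open ≡-Reasoning
  factor : ∀ a b c d e → a * b * c + (a * d + e) ≡ a * (b * c + d) + e
  factor = solve-∀

⋆-identityˡ : ∀ A → 𝟙 ⋆ A ≗ A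
⋆-identityˡ A n = trans (cong (A n + 0 +_) (∑-zero n)) (trans (+-identityʳ (A n + 0)) (+-identityʳ (A n)))

⋆-identityʳ : ∀ A → A ⋆ 𝟙 ≗ A
⋆-identityʳ A n = trans (⋆-comm A 𝟙 n) (⋆-identityˡ A n)

infix 8 x·_
x·_ : Series → Series
(x· A) zero    = 0
(x· A) (suc m) = A m

X⋆≗x· : ∀ A → X ⋆ A ≗ x· A
X⋆≗x· A zero    = refl
X⋆≗x· A (suc m) = ⋆-identityˡ A m

x·-cong : ∀ {A B} → A ≗ B → x· A ≗ x· B
x·-cong A≗B zero    = refl
x·-cong A≗B (suc m) = A≗B m

x·-⊕ : ∀ A B → x· (A ⊕ B) ≗ x· A ⊕ x· B
x·-⊕ A B zero    = refl
x·-⊕ A B (suc m) = refl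

x·-⋆ : ∀ A B → (x· A) ⋆ B ≗ x· (A ⋆ B)
x·-⋆ A B zero    = refl
x·-⋆ A B (suc m) = refl

⋆-x· : ∀ A B → A ⋆ (x· B) ≗ x· (A ⋆ B)
⋆-x· A B m = trans (⋆-comm A (x· B) m) (trans (x·-⋆ B A m) (x·-cong (⋆-comm B A) m))

⋆-split : ∀ A B m → (A ⋆ B) m ≡ A 0 * B m + (x· ((A ∘ suc) ⋆ B)) m
⋆-split A B zero    = refl
⋆-split A B (suc m) = refl

⋆-zeroˡ : ∀ B → (λ _ → 0) ⋆ B ≗ (λ _ → 0)
⋆-zeroˡ B m = ∑-zero (suc m)

⋆-distribʳ-∑ : ∀ n (F : ℕ → Series) B → (λ i → ∑ n (λ j → F j i)) ⋆ B ≗ (λ m → ∑ n (λ j → (F j ⋆ B) m))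
⋆-distribʳ-∑ zero    F B = ⋆-zeroˡ B
⋆-distribʳ-∑ (suc n) F B m =
  trans (⋆-distribʳ-⊕ (F 0) (λ i → ∑ n (λ j → F (suc j) i)) B m)
        (cong ((F 0 ⋆ B) m +_) (⋆-distribʳ-∑ n (F ∘ suc) B m))

x·⋆-distribʳ-⊕ : ∀ A A′ B → x· ((A ⊕ A′) ⋆ B) ≗ x· (A ⋆ B) ⊕ x· (A′ ⋆ B)
x·⋆-distribʳ-⊕ A A′ B m = trans (x·-cong (⋆-distribʳ-⊕ A A′ B) m) (x·-⊕ (A ⋆ B) (A′ ⋆ B) m)

x·⋆-distribʳ-∑ : ∀ n (F : ℕ → Series) B →
                 x· ((λ i → ∑ n (λ j → F j i)) ⋆ B) ≗ (λ m → ∑ n (λ j → (x· (F j ⋆ B)) m))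
x·⋆-distribʳ-∑ n F B zero    = sym (∑-zero n)
x·⋆-distribʳ-∑ n F B (suc m) = ⋆-distribʳ-∑ n F B m

x·⋆-distribʳ-if : ∀ r A B → x· ((λ i → if r then A i else 0) ⋆ B) ≗ (λ m → if r then (x· (A ⋆ B)) m else 0)
x·⋆-distribʳ-if true  A B m       = refl
x·⋆-distribʳ-if false A B zero    = refl
x·⋆-distribʳ-if false A B (suc m) = ⋆-zeroˡ B m

Causal : (Series → Series) → Set
Causal F = ∀ {Y Z} n → (∀ i → i ≤ n → Y i ≡ Z i) → F Y n ≡ F Z n

x·-fixpoint-unique : ∀ {F Y Z} → Causal F → Y ≗ x· F Y → Z ≗ x· F Z → Y ≗ Z
x·-fixpoint-unique {F} {Y} {Z} causal Y≗ Z≗ n = agreeUpTo n n ≤-refl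
  where
  agreeUpTo : ∀ n i → i ≤ n → Y i ≡ Z i
  agreeUpTo n zero _ = trans (Y≗ 0) (sym (Z≗ 0))
  agreeUpTo (suc n) (suc i) (s≤s i≤n) = begin
    Y (suc i)           ≡⟨ Y≗ (suc i) ⟩
    F Y i               ≡⟨ causal i (λ j j≤i → agreeUpTo n j (≤-trans j≤i i≤n)) ⟩
    F Z i               ≡⟨ sym (Z≗ (suc i)) ⟩
    Z (suc i)           ∎
    where open ≡-Reasoning

State : Set
State = ℕ × Bool

data Step : State → State → Set where
  vertical    : ∀ {k r} (j : Fin (suc k)) → Step (k , r) (toℕ j , true)
  horizontal₁ : ∀ {k r} → Step (k , r) (suc k , false)
  horizontal₂ : ∀ {k} → Step (k , true) (suc k , true)

infixl 5 _▷_
data Walk (s : State) : State → ℕ → Set where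
  ε   : Walk s s 0
  _▷_ : ∀ {t u m} → Walk s t m → Step t u → Walk s u (suc m)

Walks : State → ℕ → Set
Walks s m = Σ State (λ t → Walk s t m)

infixr 5 _◁_
_◁_ : ∀ {s u t m} → Step s u → Walk u t m → Walk s t (suc m)
step ◁ ε       = ε ▷ step
step ◁ (w ▷ x) = (step ◁ w) ▷ x

firstStep : ∀ {s t m} → Walk s t (suc m) → Σ State (λ u → Step s u × Walk u t m)
firstStep (ε ▷ x) = _ , x , ε
firstStep (w ▷ y ▷ x) with firstStep (w ▷ y)
... | u , step , w′ = u , step , w′ ▷ x

firstStep-◁ : ∀ {s u t m} (step : Step s u) (w : Walk u t m) → firstStep (step ◁ w) ≡ (u , step , w)
firstStep-◁ step ε                 = refl
firstStep-◁ step (ε ▷ x)           = refl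
firstStep-◁ step (w ▷ y ▷ x) rewrite firstStep-◁ step (w ▷ y) = refl

◁-firstStep : ∀ {s t m} (w : Walk s t (suc m)) → proj₁ (proj₂ (firstStep w)) ◁ proj₂ (proj₂ (firstStep w)) ≡ w
◁-firstStep (ε ▷ x) = refl
◁-firstStep (w ▷ y ▷ x) with firstStep (w ▷ y) | ◁-firstStep (w ▷ y)
... | _ , _ , _ | eq = cong (_▷ x) eq

Walks-suc↔ : ∀ s m → Walks s (suc m) ↔ Σ State (λ u → Step s u × Walks u m)
Walks-suc↔ s m = mk↔ₛ′ split join join-split split-join
  where
  split : Walks s (suc m) → Σ State (λ u → Step s u × Walks u m)
  split (t , w) with firstStep w
  ... | u , step , w′ = u , step , t , w′
  join : Σ State (λ u → Step s u × Walks u m) → Walks s (suc m)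
  join (u , step , t , w) = t , step ◁ w
  join-split : ∀ x → split (join x) ≡ x
  join-split (u , step , t , w) rewrite firstStep-◁ step w = refl
  split-join : ∀ x → join (split x) ≡ x
  split-join (t , w) = cong (t ,_) (◁-firstStep w)

Step↔ : ∀ k r (Y : State → Set) →
        Σ State (λ u → Step (k , r) u × Y u) ↔
        (Σ (Fin (suc k)) (λ j → Y (toℕ j , true)) ⊎ (Y (suc k , false) ⊎ (if r then Y (suc k , true) else ⊥)))
Step↔ k r Y = mk↔ₛ′ (to r) (from r) (to-from r) (from-to r)
  where
  to : ∀ r → Σ State (λ u → Step (k , r) u × Y u) → _
  to r (_ , vertical j , y) = inj₁ (j , y)
  to r (_ , horizontal₁ , y) = inj₂ (inj₁ y)
  to .true (_ , horizontal₂ , y) = inj₂ (inj₂ y)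
  from : ∀ r → Σ (Fin (suc k)) (λ j → Y (toℕ j , true)) ⊎ (Y (suc k , false) ⊎ (if r then Y (suc k , true) else ⊥)) →
         Σ State (λ u → Step (k , r) u × Y u)
  from r (inj₁ (j , y)) = _ , vertical j , y
  from r (inj₂ (inj₁ y)) = _ , horizontal₁ , y
  from true (inj₂ (inj₂ y)) = _ , horizontal₂ , y
  to-from : ∀ r x → to r (from r x) ≡ x
  to-from r (inj₁ _) = refl
  to-from r (inj₂ (inj₁ _)) = refl
  to-from true (inj₂ (inj₂ _)) = refl
  from-to : ∀ r x → from r (to r x) ≡ x
  from-to r (_ , vertical j , y) = refl
  from-to r (_ , horizontal₁ , y) = refl
  from-to .true (_ , horizontal₂ , y) = refl

⊎-Fin↔ : ∀ {A B : Set} {m n} → A ↔ Fin m → B ↔ Fin n → (A ⊎ B) ↔ Fin (m + n)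
⊎-Fin↔ A↔ B↔ = ↔-trans (A↔ ⊎-↔ B↔) (↔-sym +↔⊎)

Σ-Fin↔ : ∀ n (g : ℕ → ℕ) {B : Fin n → Set} → (∀ i → B i ↔ Fin (g (toℕ i))) → Σ (Fin n) B ↔ Fin (∑ n g)
Σ-Fin↔ zero    g B↔ = mk↔ₛ′ (λ { (() , _) }) (λ ()) (λ ()) (λ { (() , _) })
Σ-Fin↔ (suc n) g {B} B↔ = ↔-trans splitFirst (⊎-Fin↔ (B↔ fzero) (Σ-Fin↔ n (g ∘ suc) (B↔ ∘ fsuc)))
  where
  splitFirst : Σ (Fin (suc n)) B ↔ (B fzero ⊎ Σ (Fin n) (B ∘ fsuc))
  splitFirst = mk↔ₛ′ (λ { (fzero , x) → inj₁ x ; (fsuc i , x) → inj₂ (i , x) })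
                     (λ { (inj₁ x) → fzero , x ; (inj₂ (i , x)) → fsuc i , x })
                     (λ { (inj₁ x) → refl ; (inj₂ (i , x)) → refl })
                     (λ { (fzero , x) → refl ; (fsuc i , x) → refl })

walkCount : ℕ → Bool → ℕ → ℕ
walkCount k r zero    = 1
walkCount k r (suc m) =
  ∑ (suc k) (λ j → walkCount j true m) + (walkCount (suc k) false m + (if r then walkCount (suc k) true m else 0))

Walks↔Fin : ∀ m k r → Walks (k , r) m ↔ Fin (walkCount k r m)
Walks↔Fin zero    k r = mk↔ₛ′ (λ _ → fzero) (λ _ → (k , r) , ε) (λ { fzero → refl ; (fsuc ()) }) (λ { (_ , ε) → refl })
Walks↔Fin (suc m) k r =
  ↔-trans (Walks-suc↔ (k , r) m)
  (↔-trans (Step↔ k r (λ u → Walks u m))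
           (⊎-Fin↔ (Σ-Fin↔ (suc k) (λ j → walkCount j true m) (λ j → Walks↔Fin m (toℕ j) true))
                   (⊎-Fin↔ (Walks↔Fin m (suc k) false) (topStep↔ r))))
  where
  topStep↔ : ∀ r → (if r then Walks (suc k , true) m else ⊥) ↔ Fin (if r then walkCount (suc k) true m else 0)
  topStep↔ true  = Walks↔Fin m (suc k) true
  topStep↔ false = ↔-sym 0↔⊥

startCount wideCount : Series
startCount = walkCount 0 false
wideCount  = walkCount 0 true

if-distrib-+ : ∀ r x y → (if r then x + y else 0) ≡ (if r then x else 0) + (if r then y else 0)
if-distrib-+ true  x y = refl
if-distrib-+ false x y = refl

-- Induction on m: of the vertical steps from height k + 1, the one to j = 0 contributes
-- wideCount m and the others are those from height k, shifted by one.
walkCount-suc : ∀ m k r → walkCount (suc k) r m ≡ walkCount k r m + (x· (walkCount k r ⋆ wideCount)) m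
walkCount-suc zero    k r = refl
walkCount-suc (suc m) k r = begin
  (a + ∑ (suc k) (λ j → N (suc j) true m)) + (N (2 + k) false m + (if r then N (2 + k) true m else 0))
    ≡⟨ cong₂ (λ x y → (a + x) + y)
         (trans (∑-cong (suc k) (λ j _ → walkCount-suc m j true))
                (∑-distrib-+ (suc k) (λ j → N j true m) (λ j → (x· (N j true ⋆ wideCount)) m)))
         (cong₂ _+_ (walkCount-suc m (suc k) false)
                    (trans (cong (λ z → if r then z else 0) (walkCount-suc m (suc k) true)) (if-distrib-+ r _ _))) ⟩
  (a + (b + c)) + ((d + e) + (f + g))
    ≡⟨ regroup a b c d e f g ⟩
  (b + (d + f)) + (1 * a + (c + (e + g)))
    ≡⟨ cong (λ z → (b + (d + f)) + (1 * a + z)) (sym tail-⋆) ⟩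
  N k r (suc m) + (1 * a + (x· ((N k r ∘ suc) ⋆ wideCount)) m)
    ≡⟨ cong (N k r (suc m) +_) (sym (⋆-split (N k r) wideCount m)) ⟩
  N k r (suc m) + (N k r ⋆ wideCount) m
    ∎
  where
  open ≡-Reasoning
  N = walkCount
  a = wideCount m
  b = ∑ (suc k) (λ j → N j true m)
  c = ∑ (suc k) (λ j → (x· (N j true ⋆ wideCount)) m)
  d = N (suc k) false m
  e = (x· (N (suc k) false ⋆ wideCount)) m
  f = if r then N (suc k) true m else 0
  g = if r then (x· (N (suc k) true ⋆ wideCount)) m else 0
  -- the factor 1 is walkCount k r 0, so that 1 * a is the first term of (walkCount k r ⋆ wideCount) m
  regroup : ∀ a b c d e f g → (a + (b + c)) + ((d + e) + (f + g)) ≡ (b + (d + f)) + (1 * a + (c + (e + g)))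
  regroup = solve-∀
  tail-⋆ : (x· ((N k r ∘ suc) ⋆ wideCount)) m ≡ c + (e + g)
  tail-⋆ =
    trans (x·⋆-distribʳ-⊕ (λ i → ∑ (suc k) (λ j → N j true i))
                          (λ i → N (suc k) false i + (if r then N (suc k) true i else 0)) wideCount m)
    (cong₂ _+_ (x·⋆-distribʳ-∑ (suc k) (λ j → N j true) wideCount m)
      (trans (x·⋆-distribʳ-⊕ (N (suc k) false) (λ i → if r then N (suc k) true i else 0) wideCount m)
             (cong (e +_) (x·⋆-distribʳ-if r (N (suc k) true) wideCount m))))

startCount-suc : ∀ m → startCount (suc m) ≡ wideCount m + (startCount m + (x· (startCount ⋆ wideCount)) m)
startCount-suc m = cong₂ _+_ (+-identityʳ (wideCount m)) (trans (+-identityʳ _) (walkCount-suc m 0 false))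

wideCount-suc : ∀ m → wideCount (suc m) ≡
  wideCount m + ((startCount m + (x· (startCount ⋆ wideCount)) m) + (wideCount m + (x· (wideCount ⋆ wideCount)) m))
wideCount-suc m = cong₂ _+_ (+-identityʳ (wideCount m)) (cong₂ _+_ (walkCount-suc m 0 false) (walkCount-suc m 0 true))

H L H₁ L₁ : Series
H  = x· startCount
L  = x· wideCount
H₁ = H ⊕ 𝟙
L₁ = L ⊕ 𝟙

startCount≗ : startCount ≗ H₁ ⋆ L₁
startCount≗ zero    = refl
startCount≗ (suc m) = begin
  startCount (suc m)
    ≡⟨ startCount-suc m ⟩
  W m + (G m + (x· (G ⋆ W)) m)
    ≡⟨ regroup (W m) (G m) ((x· (G ⋆ W)) m) ⟩
  ((x· (G ⋆ W)) m + G m) + (W m + 0)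
    ≡⟨ cong (_+ (W m + 0)) (sym (cong₂ _+_ (⋆-x· G W m) (⋆-identityʳ G m))) ⟩
  ((G ⋆ L) m + (G ⋆ 𝟙) m) + L₁ (suc m)
    ≡⟨ cong (_+ L₁ (suc m)) (sym (⋆-distribˡ-⊕ G L 𝟙 m)) ⟩
  (G ⋆ L₁) m + L₁ (suc m)
    ≡⟨ cong₂ _+_ (x·-⋆ G L₁ (suc m)) (⋆-identityˡ L₁ (suc m)) ⟨
  (H ⋆ L₁) (suc m) + (𝟙 ⋆ L₁) (suc m)
    ≡⟨ ⋆-distribʳ-⊕ H 𝟙 L₁ (suc m) ⟨
  (H₁ ⋆ L₁) (suc m)
    ∎
  where
  open ≡-Reasoning
  G = startCount
  W = wideCount
  regroup : ∀ a b c → a + (b + c) ≡ (c + b) + (a + 0)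
  regroup = solve-∀

wideCount≗ : wideCount ≗ L₁ ⋆ (H₁ ⊕ L)
wideCount≗ zero    = refl
wideCount≗ (suc m) = begin
  wideCount (suc m)
    ≡⟨ wideCount-suc m ⟩
  W m + ((G m + (x· (G ⋆ W)) m) + (W m + (x· (W ⋆ W)) m))
    ≡⟨ regroup (W m) (G m) ((x· (G ⋆ W)) m) ((x· (W ⋆ W)) m) ⟩
  (((x· (G ⋆ W)) m + W m) + (x· (W ⋆ W)) m) + ((G m + 0) + W m)
    ≡⟨ cong (λ z → ((z + W m) + (x· (W ⋆ W)) m) + ((G m + 0) + W m)) (x·-cong (⋆-comm G W) m) ⟩
  (((x· (W ⋆ G)) m + W m) + (x· (W ⋆ W)) m) + (H₁ ⊕ L) (suc m)
    ≡⟨ cong (_+ (H₁ ⊕ L) (suc m)) (cong₂ _+_ (cong₂ _+_ (⋆-x· W G m) (⋆-identityʳ W m)) (⋆-x· W W m)) ⟨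
  (((W ⋆ H) m + (W ⋆ 𝟙) m) + (W ⋆ L) m) + (H₁ ⊕ L) (suc m)
    ≡⟨ cong (λ z → (z + (W ⋆ L) m) + (H₁ ⊕ L) (suc m)) (⋆-distribˡ-⊕ W H 𝟙 m) ⟨
  ((W ⋆ H₁) m + (W ⋆ L) m) + (H₁ ⊕ L) (suc m)
    ≡⟨ cong (_+ (H₁ ⊕ L) (suc m)) (⋆-distribˡ-⊕ W H₁ L m) ⟨
  (W ⋆ (H₁ ⊕ L)) m + (H₁ ⊕ L) (suc m)
    ≡⟨ cong₂ _+_ (x·-⋆ W (H₁ ⊕ L) (suc m)) (⋆-identityˡ (H₁ ⊕ L) (suc m)) ⟨
  (L ⋆ (H₁ ⊕ L)) (suc m) + (𝟙 ⋆ (H₁ ⊕ L)) (suc m)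
    ≡⟨ ⋆-distribʳ-⊕ L 𝟙 (H₁ ⊕ L) (suc m) ⟨
  (L₁ ⋆ (H₁ ⊕ L)) (suc m)
    ∎
  where
  open ≡-Reasoning
  G = startCount
  W = wideCount
  regroup : ∀ a b c d → a + ((b + c) + (a + d)) ≡ ((c + a) + d) + ((b + 0) + a)
  regroup = solve-∀

L≗H⋆H₁ : L ≗ H ⋆ H₁
L≗H⋆H₁ = x·-fixpoint-unique {F = λ Y → L₁ ⋆ (H₁ ⊕ Y)} causal (x·-cong wideCount≗) H⋆H₁-fixed
  where
  causal : Causal (λ Y → L₁ ⋆ (H₁ ⊕ Y))
  causal n Y≡Z = ⋆-cong-≤ n {A = L₁} {A′ = L₁} (λ _ _ → refl) (λ i i≤n → cong (H₁ i +_) (Y≡Z i i≤n))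
  open ≗-Reasoning
  H⋆H₁-fixed : H ⋆ H₁ ≗ x· (L₁ ⋆ (H₁ ⊕ H ⋆ H₁))
  H⋆H₁-fixed = begin
    H ⋆ H₁                     ≈⟨ x·-⋆ startCount H₁ ⟩
    x· (startCount ⋆ H₁)       ≈⟨ x·-cong (⋆-congʳ H₁ startCount≗) ⟩
    x· (H₁ ⋆ L₁ ⋆ H₁)          ≈⟨ x·-cong (⋆-congʳ H₁ (⋆-comm H₁ L₁)) ⟩
    x· (L₁ ⋆ H₁ ⋆ H₁)          ≈⟨ x·-cong (⋆-assoc L₁ H₁ H₁) ⟩
    x· (L₁ ⋆ (H₁ ⋆ H₁))        ≈⟨ x·-cong (⋆-congˡ L₁ (⋆-distribʳ-⊕ H 𝟙 H₁)) ⟩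
    x· (L₁ ⋆ (H ⋆ H₁ ⊕ 𝟙 ⋆ H₁)) ≈⟨ x·-cong (⋆-congˡ L₁ (⊕-congˡ (H ⋆ H₁) (⋆-identityˡ H₁))) ⟩
    x· (L₁ ⋆ (H ⋆ H₁ ⊕ H₁))    ≈⟨ x·-cong (⋆-congˡ L₁ (⊕-comm (H ⋆ H₁) H₁)) ⟩
    x· (L₁ ⋆ (H₁ ⊕ H ⋆ H₁))    ∎

H-equation : H ≗ X ⋆ H₁ ⊕ X ⋆ H ⋆ H₁ ⋆ H₁
H-equation = begin
  H                                ≈⟨ x·-cong startCount≗ ⟩
  x· (H₁ ⋆ L₁)                     ≈⟨ x·-cong (⋆-congˡ H₁ (⊕-congʳ 𝟙 L≗H⋆H₁)) ⟩
  x· (H₁ ⋆ (H ⋆ H₁ ⊕ 𝟙))           ≈⟨ x·-cong (⋆-distribˡ-⊕ H₁ (H ⋆ H₁) 𝟙) ⟩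
  x· (H₁ ⋆ (H ⋆ H₁) ⊕ H₁ ⋆ 𝟙)      ≈⟨ x·-cong (⊕-cong (⋆-comm H₁ (H ⋆ H₁)) (⋆-identityʳ H₁)) ⟩
  x· (H ⋆ H₁ ⋆ H₁ ⊕ H₁)            ≈⟨ x·-⊕ (H ⋆ H₁ ⋆ H₁) H₁ ⟩
  x· (H ⋆ H₁ ⋆ H₁) ⊕ x· H₁         ≈⟨ ⊕-comm (x· (H ⋆ H₁ ⋆ H₁)) (x· H₁) ⟩
  x· H₁ ⊕ x· (H ⋆ H₁ ⋆ H₁)         ≈⟨ ⊕-cong (X⋆≗x· H₁) X⋆H⋆H₁⋆H₁ ⟨
  X ⋆ H₁ ⊕ X ⋆ H ⋆ H₁ ⋆ H₁         ∎
  where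
  open ≗-Reasoning
  X⋆H⋆H₁⋆H₁ : X ⋆ H ⋆ H₁ ⋆ H₁ ≗ x· (H ⋆ H₁ ⋆ H₁)
  X⋆H⋆H₁⋆H₁ = begin
    X ⋆ H ⋆ H₁ ⋆ H₁          ≈⟨ ⋆-congʳ H₁ (⋆-congʳ H₁ (X⋆≗x· H)) ⟩
    x· H ⋆ H₁ ⋆ H₁           ≈⟨ ⋆-congʳ H₁ (x·-⋆ H H₁) ⟩
    x· (H ⋆ H₁) ⋆ H₁         ≈⟨ x·-⋆ (H ⋆ H₁) H₁ ⟩
    x· (H ⋆ H₁ ⋆ H₁)         ∎

if-≡ᵇ-refl : ∀ {A : Set} h {a b : A} → (if h ≡ᵇ h then a else b) ≡ a
if-≡ᵇ-refl zero    = refl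
if-≡ᵇ-refl (suc h) = if-≡ᵇ-refl h

if-≡ᵇ-≢ : ∀ {A : Set} {h k} {a b : A} → h ≢ k → (if h ≡ᵇ k then a else b) ≡ b
if-≡ᵇ-≢ {h = zero}  {zero}  h≢k = ⊥-elim (h≢k refl)
if-≡ᵇ-≢ {h = zero}  {suc k} h≢k = refl
if-≡ᵇ-≢ {h = suc h} {zero}  h≢k = refl
if-≡ᵇ-≢ {h = suc h} {suc k} h≢k = if-≡ᵇ-≢ {h = h} {k} (h≢k ∘′ cong suc)

lastCol : List Col → Col
lastCol []           = (0 , 0)
lastCol (c ∷ [])     = c
lastCol (_ ∷ d ∷ cs) = lastCol (d ∷ cs)

lastLo : List Col → ℕ
lastLo P = proj₁ (lastCol P)

lastHi-lastCol : ∀ P → lastHi P ≡ proj₂ (lastCol P)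
lastHi-lastCol []           = refl
lastHi-lastCol (c ∷ [])     = refl
lastHi-lastCol (c ∷ d ∷ cs) = lastHi-lastCol (d ∷ cs)

lastCol-map : ∀ f c cs → lastCol (map f (c ∷ cs)) ≡ f (lastCol (c ∷ cs))
lastCol-map f c []       = refl
lastCol-map f c (d ∷ cs) = lastCol-map f d cs

head≤lastHi : ∀ {c cs} → ColsOK (c ∷ cs) → proj₂ c ≤ lastHi (c ∷ cs)
head≤lastHi (one _)              = ≤-refl
head≤lastHi (cons _ _ h≤h′ _ ok) = ≤-trans h≤h′ (head≤lastHi ok)

lastLo<lastHi : ∀ {P} → ColsOK P → lastLo P < lastHi P
lastLo<lastHi (one l<h)           = l<h
lastLo<lastHi (cons _ _ _ _ ok)   = lastLo<lastHi ok

IsPP⇒ColsOK : ∀ {P} → IsPP P → ColsOK P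
IsPP⇒ColsOK (isPP ok) = ok

ColsOK⇒length-pos : ∀ {P} → ColsOK P → 1 ≤ length P
ColsOK⇒length-pos (one _)          = s≤s z≤n
ColsOK⇒length-pos (cons _ _ _ _ _) = s≤s z≤n

lastHi-pos : ∀ {P} → ColsOK P → 1 ≤ lastHi P
lastHi-pos ok = ≤-trans (s≤s z≤n) (lastLo<lastHi ok)

size-suc : ∀ {P Q} → 1 ≤ length Q → length P + lastHi P ≡ suc (length Q + lastHi Q) → size P ≡ suc (size Q)
size-suc {P} {Q} 1≤len eq = trans (cong (_∸ 1) eq) (sym (m+[n∸m]≡n (≤-trans 1≤len (m≤m+n (length Q) (lastHi Q)))))

topRowWidth-pos : ∀ {P} → ColsOK P → 1 ≤ topRowWidth P
topRowWidth-pos {(l , h) ∷ []}     (one _) rewrite if-≡ᵇ-refl h {1} {0} = ≤-refl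
topRowWidth-pos {(l , h) ∷ d ∷ cs} (cons _ _ _ _ ok) =
  ≤-trans (topRowWidth-pos ok) (m≤n+m _ (if h ≡ᵇ lastHi (d ∷ cs) then 1 else 0))

next-reachesTop : ∀ {l h l′ h′ cs} → ColsOK ((l , h) ∷ (l′ , h′) ∷ cs) →
                  h ≡ lastHi ((l′ , h′) ∷ cs) → h′ ≡ lastHi ((l′ , h′) ∷ cs)
next-reachesTop (cons _ _ h≤h′ _ ok) h≡top = ≤-antisym (head≤lastHi ok) (subst (_≤ _) h≡top h≤h′)

topRowWidth≡length : ∀ {c cs} → ColsOK (c ∷ cs) → proj₂ c ≡ lastHi (c ∷ cs) → topRowWidth (c ∷ cs) ≡ length (c ∷ cs)
topRowWidth≡length {(l , h)} (one _) _ = cong (_+ 0) (if-≡ᵇ-refl h)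
topRowWidth≡length {(l , h)} {(l′ , h′) ∷ cs} ok@(cons _ _ _ _ ok′) h≡top =
  cong₂ _+_ (trans (cong (λ z → if z ≡ᵇ top then 1 else 0) h≡top) (if-≡ᵇ-refl top))
            (topRowWidth≡length ok′ (next-reachesTop ok h≡top))
  where top = lastHi ((l′ , h′) ∷ cs)

raiseCol : Col → Col
raiseCol (l , h) = (l , suc h)

raiseLast : List Col → List Col
raiseLast []           = []
raiseLast (c ∷ [])     = raiseCol c ∷ []
raiseLast (c ∷ d ∷ cs) = c ∷ raiseLast (d ∷ cs)

raiseLastTwo : List Col → List Col
raiseLastTwo []               = []
raiseLastTwo (c ∷ [])         = raiseCol c ∷ []
raiseLastTwo (c ∷ d ∷ [])     = raiseCol c ∷ raiseCol d ∷ []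
raiseLastTwo (c ∷ d ∷ e ∷ cs) = c ∷ raiseLastTwo (d ∷ e ∷ cs)

PenultimateAtTop : List Col → Set
PenultimateAtTop []               = ⊥
PenultimateAtTop (c ∷ [])         = ⊥
PenultimateAtTop (c ∷ d ∷ [])     = proj₂ c ≡ proj₂ d
PenultimateAtTop (c ∷ d ∷ e ∷ cs) = PenultimateAtTop (d ∷ e ∷ cs)

below-suc-top : ∀ {c cs} → ColsOK (c ∷ cs) → proj₂ c ≢ suc (lastHi (c ∷ cs))
below-suc-top ok = <⇒≢ (s≤s (head≤lastHi ok))

raiseLast-ColsOK : ∀ {Q} → ColsOK Q → ColsOK (raiseLast Q)
raiseLast-ColsOK (one l<h) = one (m<n⇒m<1+n l<h)
raiseLast-ColsOK {_ ∷ _ ∷ []}    (cons l<h l≤l′ h≤h′ l′<h ok) =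
  cons l<h l≤l′ (m≤n⇒m≤1+n h≤h′) l′<h (raiseLast-ColsOK ok)
raiseLast-ColsOK {_ ∷ _ ∷ _ ∷ _} (cons l<h l≤l′ h≤h′ l′<h ok) =
  cons l<h l≤l′ h≤h′ l′<h (raiseLast-ColsOK ok)

raiseLast-IsPP : ∀ {Q} → IsPP Q → IsPP (raiseLast Q)
raiseLast-IsPP {_ ∷ []}    (isPP ok) = isPP (raiseLast-ColsOK ok)
raiseLast-IsPP {_ ∷ _ ∷ _} (isPP ok) = isPP (raiseLast-ColsOK ok)

length-raiseLast : ∀ Q → length (raiseLast Q) ≡ length Q
length-raiseLast []           = refl
length-raiseLast (c ∷ [])     = refl
length-raiseLast (c ∷ d ∷ cs) = cong suc (length-raiseLast (d ∷ cs))

lastCol-raiseLast : ∀ {Q} → ColsOK Q → lastCol (raiseLast Q) ≡ raiseCol (lastCol Q)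
lastCol-raiseLast (one _)                                  = refl
lastCol-raiseLast {_ ∷ _ ∷ []}    (cons _ _ _ _ _)         = refl
lastCol-raiseLast {_ ∷ _ ∷ _ ∷ _} (cons _ _ _ _ ok)        = lastCol-raiseLast ok

lastHi-raiseLast : ∀ {Q} → ColsOK Q → lastHi (raiseLast Q) ≡ suc (lastHi Q)
lastHi-raiseLast {Q} ok =
  trans (lastHi-lastCol (raiseLast Q)) (trans (cong proj₂ (lastCol-raiseLast ok)) (cong suc (sym (lastHi-lastCol Q))))

lowerTop-raiseLast : ∀ {Q} → ColsOK Q → map (lowerTop (suc (lastHi Q))) (raiseLast Q) ≡ Q
lowerTop-raiseLast {(l , h) ∷ []} (one _) = cong [_] (if-≡ᵇ-refl (suc h))
lowerTop-raiseLast {_ ∷ _ ∷ _} ok@(cons _ _ _ _ ok′) = cong₂ _∷_ (if-≡ᵇ-≢ (below-suc-top ok)) (lowerTop-raiseLast ok′)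

countTop-raiseLast : ∀ {Q} → ColsOK Q → countTop (suc (lastHi Q)) (raiseLast Q) ≡ 1
countTop-raiseLast {(l , h) ∷ []} (one _) = cong (_+ 0) (if-≡ᵇ-refl (suc h))
countTop-raiseLast {_ ∷ _ ∷ _} ok@(cons _ _ _ _ ok′) = cong₂ _+_ (if-≡ᵇ-≢ (below-suc-top ok)) (countTop-raiseLast ok′)

raiseLastTwo-ColsOK : ∀ {Q} → ColsOK Q → PenultimateAtTop Q → ColsOK (raiseLastTwo Q)
raiseLastTwo-ColsOK {_ ∷ _ ∷ []} (cons l<h l≤l′ _ l′<h (one l′<h′)) refl =
  cons (m<n⇒m<1+n l<h) l≤l′ ≤-refl (m<n⇒m<1+n l′<h) (one (m<n⇒m<1+n l′<h′))
raiseLastTwo-ColsOK {_ ∷ _ ∷ _ ∷ []} (cons l<h l≤l′ h≤h′ l′<h ok) top =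
  cons l<h l≤l′ (m≤n⇒m≤1+n h≤h′) l′<h (raiseLastTwo-ColsOK ok top)
raiseLastTwo-ColsOK {_ ∷ _ ∷ _ ∷ _ ∷ _} (cons l<h l≤l′ h≤h′ l′<h ok) top =
  cons l<h l≤l′ h≤h′ l′<h (raiseLastTwo-ColsOK ok top)

raiseLastTwo-IsPP : ∀ {Q} → IsPP Q → PenultimateAtTop Q → IsPP (raiseLastTwo Q)
raiseLastTwo-IsPP {_ ∷ _ ∷ []}    (isPP ok) top = isPP (raiseLastTwo-ColsOK ok top)
raiseLastTwo-IsPP {_ ∷ _ ∷ _ ∷ _} (isPP ok) top = isPP (raiseLastTwo-ColsOK ok top)

length-raiseLastTwo : ∀ Q → length (raiseLastTwo Q) ≡ length Q
length-raiseLastTwo []               = refl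
length-raiseLastTwo (c ∷ [])         = refl
length-raiseLastTwo (c ∷ d ∷ [])     = refl
length-raiseLastTwo (c ∷ d ∷ e ∷ cs) = cong suc (length-raiseLastTwo (d ∷ e ∷ cs))

lastCol-raiseLastTwo : ∀ {Q} → ColsOK Q → lastCol (raiseLastTwo Q) ≡ raiseCol (lastCol Q)
lastCol-raiseLastTwo (one _)                                     = refl
lastCol-raiseLastTwo {_ ∷ _ ∷ []}        (cons _ _ _ _ _)        = refl
lastCol-raiseLastTwo {_ ∷ _ ∷ _ ∷ []}    (cons _ _ _ _ _)        = refl
lastCol-raiseLastTwo {_ ∷ _ ∷ _ ∷ _ ∷ _} (cons _ _ _ _ ok)       = lastCol-raiseLastTwo ok

lastHi-raiseLastTwo : ∀ {Q} → ColsOK Q → lastHi (raiseLastTwo Q) ≡ suc (lastHi Q)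
lastHi-raiseLastTwo {Q} ok =
  trans (lastHi-lastCol (raiseLastTwo Q)) (trans (cong proj₂ (lastCol-raiseLastTwo ok)) (cong suc (sym (lastHi-lastCol Q))))

lowerTop-raiseLastTwo : ∀ {Q} → ColsOK Q → PenultimateAtTop Q → map (lowerTop (suc (lastHi Q))) (raiseLastTwo Q) ≡ Q
lowerTop-raiseLastTwo {(l , h) ∷ (l′ , .h) ∷ []} (cons _ _ _ _ (one _)) refl
  rewrite if-≡ᵇ-refl (suc h) {l , h} {l , suc h} | if-≡ᵇ-refl (suc h) {l′ , h} {l′ , suc h} = refl
lowerTop-raiseLastTwo {_ ∷ _ ∷ _ ∷ _} ok@(cons _ _ _ _ ok′) top =
  cong₂ _∷_ (if-≡ᵇ-≢ (below-suc-top ok)) (lowerTop-raiseLastTwo ok′ top)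

countTop-raiseLastTwo : ∀ {Q} → ColsOK Q → PenultimateAtTop Q → countTop (suc (lastHi Q)) (raiseLastTwo Q) ≡ 2
countTop-raiseLastTwo {(l , h) ∷ (l′ , .h) ∷ []} (cons _ _ _ _ (one _)) refl rewrite if-≡ᵇ-refl (suc h) {1} {0} = refl
countTop-raiseLastTwo {_ ∷ _ ∷ _ ∷ _} ok@(cons _ _ _ _ ok′) top =
  cong₂ _+_ (if-≡ᵇ-≢ (below-suc-top ok)) (countTop-raiseLastTwo ok′ top)

addColumn : List Col → ℕ → List Col
addColumn Q l = Q ∷ʳ (l , lastHi Q)

∷ʳ-ColsOK : ∀ {Q l} → ColsOK Q → lastLo Q ≤ l → l < lastHi Q → ColsOK (Q ∷ʳ (l , lastHi Q))
∷ʳ-ColsOK {_ ∷ []}    (one l₀<h₀) lo≤l l<hi = cons l₀<h₀ lo≤l ≤-refl l<hi (one l<hi)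
∷ʳ-ColsOK {_ ∷ _ ∷ _} (cons l<h l≤l′ h≤h′ l′<h ok) lo≤l l<hi = cons l<h l≤l′ h≤h′ l′<h (∷ʳ-ColsOK ok lo≤l l<hi)

addColumn-IsPP : ∀ {Q l} → IsPP Q → lastLo Q ≤ l → l < lastHi Q → IsPP (addColumn Q l)
addColumn-IsPP (isPP ok) lo≤l l<hi = isPP (∷ʳ-ColsOK ok lo≤l l<hi)

length-∷ʳ : ∀ Q (x : Col) → length (Q ∷ʳ x) ≡ suc (length Q)
length-∷ʳ []       x = refl
length-∷ʳ (c ∷ cs) x = cong suc (length-∷ʳ cs x)

lastCol-∷ʳ : ∀ Q x → lastCol (Q ∷ʳ x) ≡ x
lastCol-∷ʳ []           x = refl
lastCol-∷ʳ (c ∷ [])     x = refl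
lastCol-∷ʳ (c ∷ d ∷ cs) x = lastCol-∷ʳ (d ∷ cs) x

lastHi-∷ʳ : ∀ Q x → lastHi (Q ∷ʳ x) ≡ proj₂ x
lastHi-∷ʳ Q x = trans (lastHi-lastCol (Q ∷ʳ x)) (cong proj₂ (lastCol-∷ʳ Q x))

removeRight-∷ʳ : ∀ Q x → removeRight (Q ∷ʳ x) ≡ Q
removeRight-∷ʳ []           x = refl
removeRight-∷ʳ (c ∷ [])     x = refl
removeRight-∷ʳ (c ∷ d ∷ cs) x = cong (c ∷_) (removeRight-∷ʳ (d ∷ cs) x)

countTop-∷ʳ : ∀ k Q x → countTop k (Q ∷ʳ x) ≡ countTop k Q + countTop k [ x ]
countTop-∷ʳ k []             x = refl
countTop-∷ʳ k ((l , h) ∷ cs) x =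
  trans (cong ((if h ≡ᵇ k then 1 else 0) +_) (countTop-∷ʳ k cs x)) (sym (+-assoc (if h ≡ᵇ k then 1 else 0) _ _))

∷ʳ-lastCol : ∀ c cs → c ∷ cs ≡ removeRight (c ∷ cs) ∷ʳ lastCol (c ∷ cs)
∷ʳ-lastCol c []       = refl
∷ʳ-lastCol c (d ∷ cs) = cong (c ∷_) (∷ʳ-lastCol d cs)

length-removeRight : ∀ c cs → suc (length (removeRight (c ∷ cs))) ≡ length (c ∷ cs)
length-removeRight c []       = refl
length-removeRight c (d ∷ cs) = cong suc (length-removeRight d cs)

lastLo-removeRight : ∀ {c d cs} → ColsOK (c ∷ d ∷ cs) → lastLo (removeRight (c ∷ d ∷ cs)) ≤ lastLo (c ∷ d ∷ cs)
lastLo-removeRight {cs = []}    (cons _ l≤l′ _ _ _) = l≤l′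
lastLo-removeRight {cs = _ ∷ _} (cons _ _ _ _ ok)   = lastLo-removeRight ok

lastLo<lastHi-removeRight : ∀ {c d cs} → ColsOK (c ∷ d ∷ cs) → lastLo (c ∷ d ∷ cs) < lastHi (removeRight (c ∷ d ∷ cs))
lastLo<lastHi-removeRight {cs = []}    (cons _ _ _ l′<h _) = l′<h
lastLo<lastHi-removeRight {cs = _ ∷ _} (cons _ _ _ _ ok)   = lastLo<lastHi-removeRight ok

lastHi-removeRight : ∀ c cs → 1 ≤ lastHi (removeRight (c ∷ cs)) → suc (size (removeRight (c ∷ cs))) ≡ size (c ∷ cs) →
                     lastHi (removeRight (c ∷ cs)) ≡ lastHi (c ∷ cs)
lastHi-removeRight c cs 1≤hiQ size≡ = +-cancelˡ-≡ n _ _ (begin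
  n + lastHi Q                        ≡⟨ m+[n∸m]≡n (≤-trans 1≤hiQ (m≤n+m (lastHi Q) n)) ⟨
  suc (size Q)                        ≡⟨ size≡ ⟩
  length (c ∷ cs) + lastHi P ∸ 1      ≡⟨ cong (λ l → l + lastHi P ∸ 1) (length-removeRight c cs) ⟨
  n + lastHi P                        ∎)
  where
  open ≡-Reasoning
  P = c ∷ cs
  Q = removeRight P
  n = length Q

PenultimateAtTop-from : ∀ {Q} → ColsOK Q → 2 ≤ topRowWidth Q → PenultimateAtTop Q
PenultimateAtTop-from {(l , h) ∷ []} (one _) 2≤w rewrite if-≡ᵇ-refl h {1} {0} with 2≤w
... | s≤s ()
PenultimateAtTop-from {(l , h) ∷ (l′ , h′) ∷ []} (cons _ _ _ _ (one _)) 2≤w with h ≟ h′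
... | yes h≡h′ = h≡h′
... | no h≢h′ rewrite if-≡ᵇ-≢ {a = 1} {b = 0} h≢h′ | if-≡ᵇ-refl h′ {1} {0} with 2≤w
...   | s≤s ()
PenultimateAtTop-from {(l , h) ∷ (l′ , h′) ∷ e ∷ cs} ok@(cons _ _ _ _ ok′) 2≤w with h ≟ lastHi (e ∷ cs)
... | no h≢top rewrite if-≡ᵇ-≢ {a = 1} {b = 0} h≢top = PenultimateAtTop-from ok′ 2≤w
... | yes h≡top = PenultimateAtTop-from ok′
  (≤-trans (s≤s (s≤s z≤n)) (≤-reflexive (sym (topRowWidth≡length ok′ (next-reachesTop ok h≡top)))))

suc[∸1] : ∀ {l h} → l < h → suc (h ∸ 1) ≡ h
suc[∸1] l<h = m+[n∸m]≡n (≤-trans (s≤s z≤n) l<h)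

∸-suc-involutive : ∀ {l h} → l < h → h ∸ suc (h ∸ suc l) ≡ l
∸-suc-involutive {l} {suc h} (s≤s l≤h) = m∸[m∸n]≡n l≤h

height-∸ : ∀ {l h k} → l + suc k ≡ h → h ∸ suc l ≡ k
height-∸ {l} {k = k} refl = trans (cong (_∸ suc l) (+-suc l k)) (m+n∸m≡n l k)

raiseLast-removeTop : ∀ {P} → ColsOK P → topRowWidth P ≡ 1 → P ≡ raiseLast (removeTop P)
raiseLast-removeTop {(l , h) ∷ []} (one l<h) _ rewrite if-≡ᵇ-refl h {l , h ∸ 1} {l , h} =
  cong (λ z → [ (l , z) ]) (sym (suc[∸1] l<h))
raiseLast-removeTop {(l , h) ∷ (l′ , h′) ∷ cs} ok@(cons _ _ _ _ ok′) w≡1 with h ≟ lastHi ((l′ , h′) ∷ cs)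
... | yes h≡top with () ← trans (sym w≡1) (topRowWidth≡length ok h≡top)
... | no h≢top rewrite if-≡ᵇ-≢ {a = l , h ∸ 1} {b = l , h} h≢top | if-≡ᵇ-≢ {a = 1} {b = 0} h≢top =
  cong ((l , h) ∷_) (raiseLast-removeTop ok′ w≡1)

raiseLastTwo-removeTop : ∀ {P} → ColsOK P → topRowWidth P ≡ 2 → P ≡ raiseLastTwo (removeTop P)
raiseLastTwo-removeTop {(l , h) ∷ []} (one _) w≡2 rewrite if-≡ᵇ-refl h {1} {0} with () ← w≡2
raiseLastTwo-removeTop {(l , h) ∷ (l′ , h′) ∷ []} (cons l<h _ _ _ (one l′<h′)) w≡2 with h ≟ h′
... | yes refl rewrite if-≡ᵇ-refl h {l , h ∸ 1} {l , h} | if-≡ᵇ-refl h {l′ , h ∸ 1} {l′ , h} =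
  cong₂ (λ u v → (l , u) ∷ (l′ , v) ∷ []) (sym (suc[∸1] l<h)) (sym (suc[∸1] l′<h′))
... | no h≢h′ rewrite if-≡ᵇ-≢ {a = 1} {b = 0} h≢h′ | if-≡ᵇ-refl h′ {1} {0} with () ← w≡2
raiseLastTwo-removeTop {(l , h) ∷ (l′ , h′) ∷ e ∷ cs} ok@(cons _ _ _ _ ok′) w≡2 with h ≟ lastHi (e ∷ cs)
... | yes h≡top with () ← trans (sym w≡2) (topRowWidth≡length ok h≡top)
... | no h≢top rewrite if-≡ᵇ-≢ {a = l , h ∸ 1} {b = l , h} h≢top | if-≡ᵇ-≢ {a = 1} {b = 0} h≢top =
  cong ((l , h) ∷_) (raiseLastTwo-removeTop ok′ w≡2)

countTop-lowerTop : ∀ k P → countTop k P ≤ countTop (k ∸ 1) (map (lowerTop k) P)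
countTop-lowerTop k [] = z≤n
countTop-lowerTop k ((l , h) ∷ cs) with h ≟ k
... | yes refl rewrite if-≡ᵇ-refl h {l , h ∸ 1} {l , h} | if-≡ᵇ-refl h {1} {0} | if-≡ᵇ-refl (h ∸ 1) {1} {0} =
  s≤s (countTop-lowerTop h cs)
... | no h≢k rewrite if-≡ᵇ-≢ {a = l , h ∸ 1} {b = l , h} h≢k | if-≡ᵇ-≢ {a = 1} {b = 0} h≢k =
  ≤-trans (countTop-lowerTop k cs) (m≤n+m _ (if h ≡ᵇ k ∸ 1 then 1 else 0))

lastCol-removeTop : ∀ c cs → lastCol (removeTop (c ∷ cs)) ≡ (lastLo (c ∷ cs) , lastHi (c ∷ cs) ∸ 1)
lastCol-removeTop c cs = begin
  lastCol (map (lowerTop top) (c ∷ cs))   ≡⟨ lastCol-map (lowerTop top) c cs ⟩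
  lowerTop top (lastCol (c ∷ cs))         ≡⟨ cong (λ h → lowerTop top (lastLo (c ∷ cs) , h)) (lastHi-lastCol (c ∷ cs)) ⟨
  lowerTop top (lastLo (c ∷ cs) , top)    ≡⟨ if-≡ᵇ-refl top ⟩
  (lastLo (c ∷ cs) , top ∸ 1)             ∎
  where
  open ≡-Reasoning
  top = lastHi (c ∷ cs)

topRowWidth-removeTop : ∀ P → topRowWidth P ≤ topRowWidth (removeTop P)
topRowWidth-removeTop []       = z≤n
topRowWidth-removeTop (c ∷ cs) =
  subst (λ top → topRowWidth (c ∷ cs) ≤ countTop top (removeTop (c ∷ cs)))
        (sym (trans (lastHi-lastCol (removeTop (c ∷ cs))) (cong proj₂ (lastCol-removeTop c cs))))
        (countTop-lowerTop (lastHi (c ∷ cs)) (c ∷ cs))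

record Shape (k : ℕ) (r : Bool) (P : List Col) : Set where
  field
    polyomino : IsPP P
    height    : lastLo P + suc k ≡ lastHi P
    topRow    : if r then 2 ≤ topRowWidth P else topRowWidth P ≡ 1

open Shape

cell-Shape : Shape 0 false [ (0 , 1) ]
cell-Shape = record { polyomino = isPP (one (s≤s z≤n)) ; height = refl ; topRow = refl }

raised-height : ∀ {P Q k} → lastCol P ≡ raiseCol (lastCol Q) → lastLo Q + suc k ≡ lastHi Q →
                lastLo P + suc (suc k) ≡ lastHi P
raised-height {P} {Q} {k} last≡ height≡ = begin
  lastLo P + suc (suc k)        ≡⟨ cong (λ c → proj₁ c + suc (suc k)) last≡ ⟩
  lastLo Q + suc (suc k)        ≡⟨ +-suc (lastLo Q) (suc k) ⟩
  suc (lastLo Q + suc k)        ≡⟨ cong suc (trans height≡ (lastHi-lastCol Q)) ⟩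
  proj₂ (raiseCol (lastCol Q))  ≡⟨ cong proj₂ last≡ ⟨
  proj₂ (lastCol P)             ≡⟨ lastHi-lastCol P ⟨
  lastHi P                      ∎
  where open ≡-Reasoning

raiseLast-Shape : ∀ {k r Q} → Shape k r Q → Shape (suc k) false (raiseLast Q)
raiseLast-Shape {Q = Q} shape = record
  { polyomino = raiseLast-IsPP (polyomino shape)
  ; height    = raised-height {raiseLast Q} {Q} (lastCol-raiseLast ok) (height shape)
  ; topRow    = trans (cong (λ top → countTop top (raiseLast Q)) (lastHi-raiseLast ok)) (countTop-raiseLast ok)
  }
  where ok = IsPP⇒ColsOK (polyomino shape)

size-raiseLast : ∀ {Q} → ColsOK Q → size (raiseLast Q) ≡ suc (size Q)
size-raiseLast {Q} ok = size-suc {raiseLast Q} {Q} (ColsOK⇒length-pos ok)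
  (trans (cong₂ _+_ (length-raiseLast Q) (lastHi-raiseLast ok)) (+-suc (length Q) (lastHi Q)))

removeTop-raiseLast : ∀ {Q} → ColsOK Q → removeTop (raiseLast Q) ≡ Q
removeTop-raiseLast {Q} ok =
  trans (cong (λ top → map (lowerTop top) (raiseLast Q)) (lastHi-raiseLast ok)) (lowerTop-raiseLast ok)

Shape⇒PenultimateAtTop : ∀ {k Q} → Shape k true Q → PenultimateAtTop Q
Shape⇒PenultimateAtTop shape = PenultimateAtTop-from (IsPP⇒ColsOK (polyomino shape)) (topRow shape)

topRowWidth-raiseLastTwo : ∀ {k Q} → Shape k true Q → topRowWidth (raiseLastTwo Q) ≡ 2
topRowWidth-raiseLastTwo {Q = Q} shape =
  trans (cong (λ top → countTop top (raiseLastTwo Q)) (lastHi-raiseLastTwo ok)) (countTop-raiseLastTwo ok (Shape⇒PenultimateAtTop shape))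
  where ok = IsPP⇒ColsOK (polyomino shape)

raiseLastTwo-Shape : ∀ {k Q} → Shape k true Q → Shape (suc k) true (raiseLastTwo Q)
raiseLastTwo-Shape {Q = Q} shape = record
  { polyomino = raiseLastTwo-IsPP (polyomino shape) (Shape⇒PenultimateAtTop shape)
  ; height    = raised-height {raiseLastTwo Q} {Q} (lastCol-raiseLastTwo (IsPP⇒ColsOK (polyomino shape))) (height shape)
  ; topRow    = ≤-reflexive (sym (topRowWidth-raiseLastTwo shape))
  }

size-raiseLastTwo : ∀ {Q} → ColsOK Q → size (raiseLastTwo Q) ≡ suc (size Q)
size-raiseLastTwo {Q} ok = size-suc {raiseLastTwo Q} {Q} (ColsOK⇒length-pos ok)
  (trans (cong₂ _+_ (length-raiseLastTwo Q) (lastHi-raiseLastTwo ok)) (+-suc (length Q) (lastHi Q)))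

removeTop-raiseLastTwo : ∀ {Q} → ColsOK Q → PenultimateAtTop Q → removeTop (raiseLastTwo Q) ≡ Q
removeTop-raiseLastTwo {Q} ok top =
  trans (cong (λ t → map (lowerTop t) (raiseLastTwo Q)) (lastHi-raiseLastTwo ok)) (lowerTop-raiseLastTwo ok top)

addColumn-Shape : ∀ {k r Q j} → Shape k r Q → j ≤ k → Shape j true (addColumn Q (lastHi Q ∸ suc j))
addColumn-Shape {k} {r} {Q} {j} shape j≤k = record
  { polyomino = addColumn-IsPP (polyomino shape) lo≤l l<hi
  ; height    = trans (cong (λ c → proj₁ c + suc j) (lastCol-∷ʳ Q (l , hi)))
                      (trans (m∸n+n≡m 1+j≤hi) (sym (lastHi-∷ʳ Q (l , hi))))
  ; topRow    = begin
      2                                          ≤⟨ +-monoˡ-≤ 1 (topRowWidth-pos (IsPP⇒ColsOK (polyomino shape))) ⟩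
      countTop hi Q + 1                          ≡⟨ cong (λ n → countTop hi Q + (n + 0)) (if-≡ᵇ-refl hi) ⟨
      countTop hi Q + countTop hi [ (l , hi) ]   ≡⟨ countTop-∷ʳ hi Q (l , hi) ⟨
      countTop hi (Q ∷ʳ (l , hi))                ≡⟨ cong (λ top → countTop top (Q ∷ʳ (l , hi))) (lastHi-∷ʳ Q (l , hi)) ⟨
      topRowWidth (addColumn Q l)                ∎
  }
  where
  open ≤-Reasoning
  lo = lastLo Q
  hi = lastHi Q
  l = hi ∸ suc j
  1+j≤hi : suc j ≤ hi
  1+j≤hi = subst (suc j ≤_) (height shape) (≤-trans (s≤s j≤k) (m≤n+m (suc k) lo))
  lo≤l : lo ≤ l
  lo≤l = subst (λ h → lo ≤ h ∸ suc j) (height shape)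
          (subst (lo ≤_) (sym (+-∸-assoc lo (s≤s j≤k))) (m≤m+n lo (k ∸ j)))
  l<hi : l < hi
  l<hi = ∸-monoʳ-< (s≤s z≤n) 1+j≤hi

size-addColumn : ∀ {Q} → ColsOK Q → ∀ l → size (addColumn Q l) ≡ suc (size Q)
size-addColumn {Q} ok l = size-suc {addColumn Q l} {Q} (ColsOK⇒length-pos ok)
  (cong₂ _+_ (length-∷ʳ Q (l , lastHi Q)) (lastHi-∷ʳ Q (l , lastHi Q)))

-- Slicings and walks are compared through their lists of moves (outermost block first),
-- which also determine the polyomino.
data Move : Set where
  column    : ℕ → Move
  row₁ row₂ : Move

moveOfStep : ∀ {s t} → Step s t → Move
moveOfStep (vertical j) = column (toℕ j)
moveOfStep horizontal₁  = row₁
moveOfStep horizontal₂  = row₂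

movesOfWalk : ∀ {s t m} → Walk s t m → List Move
movesOfWalk ε          = []
movesOfWalk (w ▷ step) = moveOfStep step ∷ movesOfWalk w

rowMove : ℕ → Move
rowMove 1 = row₁
rowMove _ = row₂

movesOfSlicing : ∀ {P} → BaxterSlicing P → List Move
movesOfSlicing cell                  = []
movesOfSlicing (horiz {P} _ _ _ _ t) = rowMove (topRowWidth P) ∷ movesOfSlicing t
movesOfSlicing (vert {P} _ _ _ _ t)  = column (lastHi P ∸ suc (lastLo P)) ∷ movesOfSlicing t

applyMove : Move → List Col → List Col
applyMove (column j) Q = addColumn Q (lastHi Q ∸ suc j)
applyMove row₁       Q = raiseLast Q
applyMove row₂       Q = raiseLastTwo Q

polyominoOf : List Move → List Col
polyominoOf = foldr applyMove [ (0 , 1) ]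

TwoRowSlicingOf : List Col → Set
TwoRowSlicingOf P = Σ (BaxterSlicing P) TwoRowRestricted

size-pos : ∀ {P} → BaxterSlicing P → 1 ≤ size P
size-pos cell                = s≤s z≤n
size-pos (horiz _ 2≤n _ _ _) = ≤-trans (s≤s z≤n) 2≤n
size-pos (vert _ 2≤n _ _ _)  = ≤-trans (s≤s z≤n) 2≤n

horizontal-slicing : ∀ {P Q} → removeTop P ≡ Q → IsPP P → IsPP Q → size P ≡ suc (size Q) → topRowWidth P ≤ 2 →
  (s : TwoRowSlicingOf Q) →
  Σ (TwoRowSlicingOf P) (λ s′ → movesOfSlicing (proj₁ s′) ≡ rowMove (topRowWidth P) ∷ movesOfSlicing (proj₁ s))
horizontal-slicing refl ppP ppQ size≡ w≤2 (t , trr) =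
  (horiz ppP (subst (2 ≤_) (sym size≡) (s≤s (size-pos t))) ppQ (sym size≡) t , w≤2 , trr) , refl

vertical-slicing : ∀ {P Q} → removeRight P ≡ Q → IsPP P → IsPP Q → size P ≡ suc (size Q) →
  (s : TwoRowSlicingOf Q) →
  Σ (TwoRowSlicingOf P) (λ s′ → movesOfSlicing (proj₁ s′) ≡ column (lastHi P ∸ suc (lastLo P)) ∷ movesOfSlicing (proj₁ s))
vertical-slicing refl ppP ppQ size≡ (t , trr) =
  (vert ppP (subst (2 ≤_) (sym size≡) (s≤s (size-pos t))) ppQ (sym size≡) t , trr) , refl

record Realisation {k r m} (w : Walk (0 , false) (k , r) m) : Set where
  field
    shape   : Shape k r (polyominoOf (movesOfWalk w))
    size≡   : size (polyominoOf (movesOfWalk w)) ≡ suc m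
    slicing : TwoRowSlicingOf (polyominoOf (movesOfWalk w))
    moves≡  : movesOfSlicing (proj₁ slicing) ≡ movesOfWalk w

realise : ∀ {k r m} (w : Walk (0 , false) (k , r) m) → Realisation w
realise ε = record
  { shape   = cell-Shape
  ; size≡   = refl
  ; slicing = cell , tt
  ; moves≡  = refl
  }
realise (w ▷ vertical j) = record
  { shape   = shape′
  ; size≡   = trans size≡′ (cong suc (size≡ R))
  ; slicing = proj₁ extended
  ; moves≡  = trans (proj₂ extended) (cong₂ _∷_ (cong column (height-∸ (height shape′))) (moves≡ R))
  }
  where
  open Realisation
  R = realise w
  Q = polyominoOf (movesOfWalk w)
  shape′ = addColumn-Shape (shape R) (s≤s⁻¹ (toℕ<n j))
  size≡′ = size-addColumn (IsPP⇒ColsOK (polyomino (shape R))) (lastHi Q ∸ suc (toℕ j))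
  extended = vertical-slicing (removeRight-∷ʳ Q _) (polyomino shape′) (polyomino (shape R)) size≡′ (slicing R)
realise (w ▷ horizontal₁) = record
  { shape   = shape′
  ; size≡   = trans size≡′ (cong suc (size≡ R))
  ; slicing = proj₁ extended
  ; moves≡  = trans (proj₂ extended) (cong₂ _∷_ (cong rowMove (topRow shape′)) (moves≡ R))
  }
  where
  open Realisation
  R = realise w
  ok = IsPP⇒ColsOK (polyomino (shape R))
  shape′ = raiseLast-Shape (shape R)
  size≡′ = size-raiseLast ok
  extended = horizontal-slicing (removeTop-raiseLast ok) (polyomino shape′) (polyomino (shape R)) size≡′
               (≤-trans (≤-reflexive (topRow shape′)) (s≤s z≤n)) (slicing R)
realise (w ▷ horizontal₂) = record
  { shape   = shape′
  ; size≡   = trans size≡′ (cong suc (size≡ R))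
  ; slicing = proj₁ extended
  ; moves≡  = trans (proj₂ extended) (cong₂ _∷_ (cong rowMove (topRowWidth-raiseLastTwo (shape R))) (moves≡ R))
  }
  where
  open Realisation
  R = realise w
  ok = IsPP⇒ColsOK (polyomino (shape R))
  shape′ = raiseLastTwo-Shape (shape R)
  size≡′ = size-raiseLastTwo ok
  extended = horizontal-slicing (removeTop-raiseLastTwo ok (Shape⇒PenultimateAtTop (shape R)))
               (polyomino shape′) (polyomino (shape R)) size≡′
               (≤-reflexive (topRowWidth-raiseLastTwo (shape R))) (slicing R)

record Reading {P} (t : BaxterSlicing P) : Set where
  constructor reading
  field
    {k}        : ℕ
    {r}        : Bool
    {len}      : ℕ
    walk       : Walk (0 , false) (k , r) len
    shape      : Shape k r P
    length≡    : suc len ≡ size P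
    moves≡     : movesOfWalk walk ≡ movesOfSlicing t
    polyomino≡ : P ≡ polyominoOf (movesOfSlicing t)

extendReading : ∀ {P Q} {t : BaxterSlicing P} {t′ : BaxterSlicing Q} (R : Reading t′) →
  let open Reading R in
  ∀ {k′ r′} (step : Step (k , r) (k′ , r′)) → P ≡ applyMove (moveOfStep step) Q → Shape k′ r′ P →
  size P ≡ suc (size Q) → movesOfSlicing t ≡ moveOfStep step ∷ movesOfSlicing t′ → Reading t
extendReading (reading walk shape length≡ moves≡ polyomino≡) step P≡ shape′ size≡ movesOfSlicing≡ =
  reading (walk ▷ step) shape′ (trans (cong suc length≡) (sym size≡))
    (trans (cong (moveOfStep step ∷_) moves≡) (sym movesOfSlicing≡))
    (trans P≡ (trans (cong (applyMove (moveOfStep step)) polyomino≡) (cong polyominoOf (sym movesOfSlicing≡))))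

width-1-or-2 : ∀ {w} → 1 ≤ w → w ≤ 2 → w ≡ 1 ⊎ w ≡ 2
width-1-or-2 {1} _ _ = inj₁ refl
width-1-or-2 {2} _ _ = inj₂ refl
width-1-or-2 {suc (suc (suc _))} _ (s≤s (s≤s ()))

read-horizontal : ∀ {P} (ppP : IsPP P) (2≤n : 2 ≤ size P) (ppQ : IsPP (removeTop P))
  (size≡ : suc (size (removeTop P)) ≡ size P) {t′ : BaxterSlicing (removeTop P)} →
  topRowWidth P ≤ 2 → Reading t′ → Reading (horiz ppP 2≤n ppQ size≡ t′)
read-horizontal {P} ppP@(isPP ok) 2≤n ppQ size≡ {t′} w≤2 R with width-1-or-2 (topRowWidth-pos ok) w≤2
... | inj₁ w≡1 =
  extendReading R horizontal₁ P≡ (subst (Shape _ false) (sym P≡) (raiseLast-Shape (Reading.shape R)))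
    (sym size≡) (cong₂ _∷_ (cong rowMove w≡1) refl)
  where P≡ = raiseLast-removeTop ok w≡1
... | inj₂ w≡2 = wide R
  where
  P≡ = raiseLastTwo-removeTop ok w≡2
  2≤width : 2 ≤ topRowWidth (removeTop P)
  2≤width = subst (_≤ topRowWidth (removeTop P)) w≡2 (topRowWidth-removeTop P)
  wide : Reading t′ → Reading (horiz ppP 2≤n ppQ size≡ t′)
  wide R@(reading {r = true} _ shape _ _ _) =
    extendReading R horizontal₂ P≡ (subst (Shape _ true) (sym P≡) (raiseLastTwo-Shape shape))
      (sym size≡) (cong₂ _∷_ (cong rowMove w≡2) refl)
  wide (reading {r = false} _ shape _ _ _) with s≤s () ← subst (2 ≤_) (topRow shape) 2≤width

read-vertical : ∀ {P} (ppP : IsPP P) (2≤n : 2 ≤ size P) (ppQ : IsPP (removeRight P))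
  (size≡ : suc (size (removeRight P)) ≡ size P) {t′ : BaxterSlicing (removeRight P)} →
  Reading t′ → Reading (vert ppP 2≤n ppQ size≡ t′)
read-vertical {(0 , h) ∷ []} (isPP _) _ () _ _
read-vertical {P@((0 , h) ∷ d ∷ cs)} (isPP ok) 2≤n ppQ size≡ R@(reading {k = k} _ shape _ _ _) =
  extendReading R (vertical jF) P≡ (subst (Shape (toℕ jF) true) (sym P≡) (addColumn-Shape shape (s≤s⁻¹ (toℕ<n jF))))
    (sym size≡) (cong₂ _∷_ (cong column (sym toℕ-jF)) refl)
  where
  Q = removeRight P
  hiQ≡ : lastHi Q ≡ lastHi P
  hiQ≡ = lastHi-removeRight (0 , h) (d ∷ cs) (lastHi-pos (IsPP⇒ColsOK ppQ)) size≡
  j = lastHi P ∸ suc (lastLo P)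
  j≤k : j ≤ k
  j≤k = begin
    lastHi P ∸ suc (lastLo P)     ≡⟨ cong (_∸ suc (lastLo P)) hiQ≡ ⟨
    lastHi Q ∸ suc (lastLo P)     ≤⟨ ∸-monoʳ-≤ (lastHi Q) (s≤s (lastLo-removeRight ok)) ⟩
    lastHi Q ∸ suc (lastLo Q)     ≡⟨ height-∸ (height shape) ⟩
    k                             ∎
    where open ≤-Reasoning
  jF = fromℕ< (s≤s j≤k)
  toℕ-jF : toℕ jF ≡ j
  toℕ-jF = toℕ-fromℕ< (s≤s j≤k)
  lo≡ : lastLo P ≡ lastHi Q ∸ suc j
  lo≡ = sym (trans (cong (λ hi → hi ∸ suc j) hiQ≡)
                   (∸-suc-involutive (subst (lastLo P <_) hiQ≡ (lastLo<lastHi-removeRight ok))))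
  P≡ : P ≡ applyMove (column (toℕ jF)) Q
  P≡ = begin
    P                                        ≡⟨ ∷ʳ-lastCol (0 , h) (d ∷ cs) ⟩
    Q ∷ʳ lastCol P                           ≡⟨ cong (Q ∷ʳ_) (cong₂ _,_ lo≡ (trans (sym (lastHi-lastCol P)) (sym hiQ≡))) ⟩
    addColumn Q (lastHi Q ∸ suc j)           ≡⟨ cong (λ i → addColumn Q (lastHi Q ∸ suc i)) toℕ-jF ⟨
    addColumn Q (lastHi Q ∸ suc (toℕ jF))    ∎
    where open ≡-Reasoning

read : ∀ {P} (t : BaxterSlicing P) → TwoRowRestricted t → Reading t
read cell                              _           = reading ε cell-Shape refl refl refl
read (horiz ppP 2≤n ppQ size≡ t)       (w≤2 , trr) = read-horizontal ppP 2≤n ppQ size≡ w≤2 (read t trr)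
read (vert ppP 2≤n ppQ size≡ t)        trr         = read-vertical ppP 2≤n ppQ size≡ (read t trr)

ColsOK-irrelevant : ∀ {P} (a b : ColsOK P) → a ≡ b
ColsOK-irrelevant (one p) (one p′) = cong one (<-irrelevant p p′)
ColsOK-irrelevant (cons p q r s ok) (cons p′ q′ r′ s′ ok′)
  rewrite <-irrelevant p p′ | ≤-irrelevant q q′ | ≤-irrelevant r r′ | <-irrelevant s s′ | ColsOK-irrelevant ok ok′ = refl

IsPP-irrelevant : ∀ {P} (a b : IsPP P) → a ≡ b
IsPP-irrelevant (isPP ok) (isPP ok′) = cong isPP (ColsOK-irrelevant ok ok′)

TwoRowRestricted-irrelevant : ∀ {P} (t : BaxterSlicing P) (a b : TwoRowRestricted t) → a ≡ b
TwoRowRestricted-irrelevant cell              _       _         = refl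
TwoRowRestricted-irrelevant (horiz _ _ _ _ t) (p , a) (p′ , b) = cong₂ _,_ (≤-irrelevant p p′) (TwoRowRestricted-irrelevant t a b)
TwoRowRestricted-irrelevant (vert _ _ _ _ t)  a       b         = TwoRowRestricted-irrelevant t a b

rowMove≢column : ∀ w j → rowMove w ≢ column j
rowMove≢column zero                j ()
rowMove≢column (suc zero)          j ()
rowMove≢column (suc (suc w))       j ()

movesOfSlicing-injective : ∀ {P} (t t′ : BaxterSlicing P) → movesOfSlicing t ≡ movesOfSlicing t′ → t ≡ t′
movesOfSlicing-injective cell cell _ = refl
movesOfSlicing-injective (horiz a b c d t) (horiz a′ b′ c′ d′ t′) eq
  rewrite IsPP-irrelevant a a′ | ≤-irrelevant b b′ | IsPP-irrelevant c c′ | ≡-irrelevant d d′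
        | movesOfSlicing-injective t t′ (∷-injectiveʳ eq) = refl
movesOfSlicing-injective (vert a b c d t) (vert a′ b′ c′ d′ t′) eq
  rewrite IsPP-irrelevant a a′ | ≤-irrelevant b b′ | IsPP-irrelevant c c′ | ≡-irrelevant d d′
        | movesOfSlicing-injective t t′ (∷-injectiveʳ eq) = refl
movesOfSlicing-injective (horiz {P} _ _ _ _ _) (vert _ _ _ _ _) eq with () ← rowMove≢column (topRowWidth P) _ (∷-injectiveˡ eq)
movesOfSlicing-injective (vert _ _ _ _ _) (horiz {P} _ _ _ _ _) eq with () ← rowMove≢column (topRowWidth P) _ (sym (∷-injectiveˡ eq))

moveOfStep-injective : ∀ {s t t′} (x : Step s t) (y : Step s t′) → moveOfStep x ≡ moveOfStep y →
                       _≡_ {A = Σ State (Step s)} (t , x) (t′ , y)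
moveOfStep-injective (vertical i) (vertical j) eq with toℕ-injective (column-injective eq)
  where
  column-injective : ∀ {i j} → column i ≡ column j → i ≡ j
  column-injective refl = refl
... | refl = refl
moveOfStep-injective horizontal₁ horizontal₁ _ = refl
moveOfStep-injective horizontal₂ horizontal₂ _ = refl

movesOfWalk-injective : ∀ {s m} (x y : Walks s m) → movesOfWalk (proj₂ x) ≡ movesOfWalk (proj₂ y) → x ≡ y
movesOfWalk-injective (_ , ε) (_ , ε) _ = refl
movesOfWalk-injective (_ , _▷_ {t} w x) (_ , _▷_ {t′} w′ y) eq
  with movesOfWalk-injective (t , w) (t′ , w′) (∷-injectiveʳ eq)
... | refl with moveOfStep-injective x y (∷-injectiveˡ eq)
...   | refl = refl

movesOfWalk-subst : ∀ {s t m m′} (eq : m ≡ m′) (w : Walk s t m) → movesOfWalk (subst (Walk s t) eq w) ≡ movesOfWalk w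
movesOfWalk-subst refl w = refl

TwoRowSlicing-≡ : ∀ {n} (x y : TwoRowSlicing n) → proj₁ x ≡ proj₁ y →
                  movesOfSlicing (proj₁ (proj₂ (proj₂ x))) ≡ movesOfSlicing (proj₁ (proj₂ (proj₂ y))) → x ≡ y
TwoRowSlicing-≡ (P , size≡ , t , trr) (.P , size≡′ , t′ , trr′) refl moves≡
  with refl ← movesOfSlicing-injective t t′ moves≡
  rewrite ≡-irrelevant size≡ size≡′ | TwoRowRestricted-irrelevant t trr trr′ = refl

TwoRowSlicing↔Walks : ∀ m → TwoRowSlicing (suc m) ↔ Walks (0 , false) m
TwoRowSlicing↔Walks m = mk↔ₛ′ toWalks fromWalks to∘from from∘to
  where
  toWalks : TwoRowSlicing (suc m) → Walks (0 , false) m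
  toWalks (P , size≡ , t , trr) = let open Reading (read t trr) in
    (k , r) , subst (Walk (0 , false) (k , r)) (suc-injective (trans length≡ size≡)) walk

  fromWalks : Walks (0 , false) m → TwoRowSlicing (suc m)
  fromWalks (_ , w) = let open Realisation (realise w) in polyominoOf (movesOfWalk w) , size≡ , slicing

  movesOf-toWalks : ∀ x → movesOfWalk (proj₂ (toWalks x)) ≡ movesOfSlicing (proj₁ (proj₂ (proj₂ x)))
  movesOf-toWalks (P , size≡ , t , trr) = let open Reading (read t trr) in
    trans (movesOfWalk-subst (suc-injective (trans length≡ size≡)) walk) moves≡

  from∘to : ∀ x → fromWalks (toWalks x) ≡ x
  from∘to x@(P , size≡ , t , trr) = TwoRowSlicing-≡ (fromWalks (toWalks x)) x
    (trans (cong polyominoOf (movesOf-toWalks x)) (sym (Reading.polyomino≡ (read t trr))))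
    (trans (Realisation.moves≡ (realise (proj₂ (toWalks x)))) (movesOf-toWalks x))

  to∘from : ∀ y → toWalks (fromWalks y) ≡ y
  to∘from y@(_ , w) = movesOfWalk-injective (toWalks (fromWalks y)) y
    (trans (movesOf-toWalks (fromWalks y)) (Realisation.moves≡ (realise w)))

genFun≗H : (a : ℕ → ℕ) → (∀ n → Fin (a n) ↔ TwoRowSlicing n) → genFun a ≗ H
genFun≗H a a↔ zero    = refl
genFun≗H a a↔ (suc m) = ↔⇒≡ (↔-trans (a↔ (suc m)) (↔-trans (TwoRowSlicing↔Walks m) (Walks↔Fin m 0 false)))

⊛-cong-⋆ : ∀ {A A′ B B′} → A ≗ A′ → B ≗ B′ → A ⊛ B ≗ A′ ⋆ B′
⊛-cong-⋆ {A} {A′} {B} {B′} A≗A′ B≗B′ n = trans (⊛≗⋆ A B n) (⋆-cong A≗A′ B≗B′ n)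

theorem13 : (a : ℕ → ℕ) → (∀ n → Fin (a n) ↔ TwoRowSlicing n) →
    ∀ n → genFun a n ≡ (X ⊛ (genFun a ⊕ 𝟙) ⊕ X ⊛ genFun a ⊛ (genFun a ⊕ 𝟙) ⊛ (genFun a ⊕ 𝟙)) n
theorem13 a a↔ = begin
  genFun a
    ≈⟨ G≗H ⟩
  H
    ≈⟨ H-equation ⟩
  X ⋆ H₁ ⊕ X ⋆ H ⋆ H₁ ⋆ H₁
    ≈⟨ ⊕-cong (⊛-cong-⋆ X≗X G₁≗H₁) (⊛-cong-⋆ (⊛-cong-⋆ (⊛-cong-⋆ X≗X G≗H) G₁≗H₁) G₁≗H₁) ⟨
  X ⊛ G₁ ⊕ X ⊛ genFun a ⊛ G₁ ⊛ G₁
    ∎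
  where
  open ≗-Reasoning
  G₁ = genFun a ⊕ 𝟙
  G≗H = genFun≗H a a↔
  G₁≗H₁ : G₁ ≗ H₁
  G₁≗H₁ = ⊕-congʳ 𝟙 G≗H
  X≗X : X ≗ X
  X≗X _ = refl
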